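{- Let $p\in(0,1)$, let $a,b$ be positive integers with $a<b$ and $\gcd(a,b)=1$, and let $n$ be a positive integer. For every integer $i$ with $0\le i\le \log_b n$, $$\mathbb{E}\big(|T^*_{i}|\big)=\frac{b-1}{b(1+p)}\,pn\left(\frac{1}{b^{i}}+\Big(-\frac{p}{b}\Big)^{i}p\right)\pm 1,$$ i.e. the two sides differ by at most $1$ in absolute value.
   Context: $[n]=\{1,\dots,n\}$ and $[n]_p$ is the random subset of $[n]$ containing each element independently with probability $p$. $D$ is the directed graph on $[n]$ with arcs $(x,y)$ whenever $(b/a)x=y$; $D[[n]_p]$ is its subgraph induced on $[n]_p$, each component of which is a directed path $u_0<u_1<\dots<u_l$ with arcs $(u_j,u_{j+1})$ ($u_j$ at distance $j$ from $u_0$). A positive integer $k$ is an $i$-th subpower of $b$ if $k=b^i l$ for some integer $l\not\equiv 0\pmod b$. $T_i$ is the set of $i$-th subpowers of $b$ in $[n]$, and $T^*_i$ is the set of $v\in T_i\cap[n]_p$ such that $v$ is at even distance from the smallest vertex of the component of $D[[n]_p]$ containing $v$.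
   Formalization: The parameter p takes only rational values in (0,1). -}

module Defs where

open import Data.Bool using (Bool; true; false; _∧_; not; if_then_else_)
open import Data.Nat as ℕ using (ℕ; zero; suc; _*_; _∸_; _^_; NonZero)
open import Data.Nat.Properties as ℕP using (*-comm; *-cancelʳ-≡; m^n≢0)
open import Data.Nat.Divisibility using (_∣_; _∣?_; divides)
open import Data.Integer using (+_)
open import Data.List using (List; []; _∷_; map; _++_; filter; length; foldr)
open import Data.Maybe using (Maybe; just; nothing)
open import Data.Product using (Σ; _×_; _,_)
open import Data.Rational using (ℚ; 0ℚ; 1ℚ; _+_; _-_; -_; 1/_; ≢-nonZero)
  renaming (_*_ to _*ℚ_; _/_ to _/ℚ_)
open import Data.Rational.Properties using (_≟_)
open import Relation.Nullary using (¬_; Dec; yes; no; ⌊_⌋)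
open import Relation.Binary.PropositionalEquality using (_≡_; refl; sym; trans; cong)

ℕ→ℚ : ℕ → ℚ
ℕ→ℚ m = + m /ℚ 1

-- total inverse (inv 0 = 0); only ever applied to nonzero arguments below
inv : ℚ → ℚ
inv q with q ≟ 0ℚ
... | yes _  = 0ℚ
... | no q≢0 = 1/_ q {{≢-nonZero q≢0}}

powℚ : ℚ → ℕ → ℚ
powℚ q zero    = 1ℚ
powℚ q (suc k) = q *ℚ powℚ q k

sumℚ : List ℚ → ℚ
sumℚ = foldr _+_ 0ℚ

-- Subsets of [n] = {1,…,n}: a list of n booleans, position k-1 says
-- whether k belongs to the subset.

allSubsets : ℕ → List (List Bool)
allSubsets zero    = [] ∷ []
allSubsets (suc n) = map (true ∷_) (allSubsets n) ++ map (false ∷_) (allSubsets n)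

mem : List Bool → ℕ → Bool
mem S       zero          = false
mem []      (suc k)       = false
mem (x ∷ S) (suc zero)    = x
mem (x ∷ S) (suc (suc k)) = mem S (suc k)

range1 : ℕ → List ℕ
range1 zero    = []
range1 (suc n) = range1 n ++ (suc n ∷ [])

prob : ℚ → List Bool → ℚ
prob p []          = 1ℚ
prob p (true ∷ S)  = p *ℚ prob p S
prob p (false ∷ S) = (1ℚ - p) *ℚ prob p S

IsSubpower : ℕ → ℕ → ℕ → Set
IsSubpower b i k = Σ ℕ λ l → (k ≡ b ^ i * l) × ¬ (b ∣ l)

subpower? : (b : ℕ) → .{{_ : NonZero b}} → (i k : ℕ) → Dec (IsSubpower b i k)
subpower? b i k with b ^ i ∣? k
... | no ¬d = no λ where (l , eq , _) → ¬d (divides l (trans eq (*-comm (b ^ i) l)))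
... | yes (divides q eq) with b ∣? q
...   | no b∤q = yes (q , trans eq (*-comm q (b ^ i)) , b∤q)
...   | yes b∣q = no λ where
          (l , eq' , b∤l) → b∤l (subst∣ (*-cancelʳ-≡ q l (b ^ i) {{m^n≢0 b i}}
                               (trans (sym eq) (trans eq' (*-comm (b ^ i) l)))) b∣q)
  where
  subst∣ : ∀ {x y} → x ≡ y → b ∣ x → b ∣ y
  subst∣ refl h = h

subpowerᵇ : ℕ → ℕ → ℕ → Bool
subpowerᵇ zero    i k = false   -- never used: b > a ≥ 1
subpowerᵇ (suc b) i k = ⌊ subpower? (suc b) i k ⌋

-- The digraph D on [n]: arc (x,y) iff (b/a) x = y, i.e. b x = a y.
-- In D[S] every vertex has at most one in-neighbour; the in-neighbour
-- of v in D[S] (if any) is found by search over [n].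

findPred : (a b n : ℕ) → List Bool → ℕ → Maybe ℕ
findPred a b n S v = go (range1 n)
  where
  go : List ℕ → Maybe ℕ
  go []       = nothing
  go (u ∷ us) = if mem S u ∧ ⌊ b * u ℕ.≟ a * v ⌋ then just u else go us

-- distance from v back to the smallest vertex of its component in D[S]
-- (follow in-arcs until none remains; fuel bounds the path length)
distFrom : (a b n : ℕ) → List Bool → (fuel v : ℕ) → ℕ
distFrom a b n S zero       v = zero
distFrom a b n S (suc fuel) v with findPred a b n S v
... | nothing = zero
... | just u  = suc (distFrom a b n S fuel u)

evenᵇ : ℕ → Bool
evenᵇ zero          = true
evenᵇ (suc zero)    = false
evenᵇ (suc (suc m)) = evenᵇ m

-- distance of v from the smallest vertex of its component (paths have < n arcs)
dist : (a b n : ℕ) → List Bool → ℕ → ℕ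
dist a b n S v = distFrom a b n S n v

TStar : (a b n i : ℕ) → List Bool → List ℕ
TStar a b n i S =
  filter (λ v → mem S v ∧ subpowerᵇ b i v ∧ evenᵇ (dist a b n S v) ≟ᵇ true) (range1 n)
  where
  open import Data.Bool.Properties using () renaming (_≟_ to _≟ᵇ_)

expectedTStar : (p : ℚ) (a b n i : ℕ) → ℚ
expectedTStar p a b n i =
  sumℚ (map (λ S → prob p S *ℚ ℕ→ℚ (length (TStar a b n i S))) (allSubsets n))

mainTerm : (p : ℚ) (b n i : ℕ) → ℚ
mainTerm p b n i =
  ((ℕ→ℚ (b ∸ 1) *ℚ inv (ℕ→ℚ b *ℚ (1ℚ + p))) *ℚ (p *ℚ ℕ→ℚ n))
    *ℚ (inv (ℕ→ℚ (b ^ i)) + (powℚ (- (p *ℚ inv (ℕ→ℚ b))) i *ℚ p))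

{-# OPTIONS --safe #-}
-- In D[[n]_p] the only possible in-neighbour of v is a v / b, which is an integer iff b ∣ v
-- (as gcd(a,b) = 1). So v is at even distance from the bottom of its component iff its in-neighbour is
-- absent or at odd distance, and for v = b^i l with b ∤ l this recursion runs down a chain of length i.
-- The in-neighbour is smaller than v, hence independent of everything that decides its own parity, so the
-- probability s_j that such a vertex at chain height j is at even distance obeys s_0 = 1, s_{j+1} = 1 - p s_j,
-- i.e. s_j (1 + p) = 1 + (-p)^j p. Thus E|T*_i| = p s_i c, where c = ⌊n/b^i⌋ - ⌊n/b^{i+1}⌋ counts the i-th
-- subpowers in [n], and c differs from (b-1) n / b^{i+1} by less than 1; since 0 ≤ p s_i ≤ 1 the error stays ≤ 1.
module Submission where

open import Defs
open import Data.Bool using (Bool; true; false; not; _∧_; if_then_else_)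
open import Data.List using (List; []; _∷_; map; _++_; take; filter; length; findᵇ)
open import Data.Maybe using (Maybe; just; nothing)
open import Data.Product using (_×_; _,_; proj₁; proj₂)
open import Data.Empty using (⊥-elim)
open import Function using (_∘_)
open import Relation.Nullary using (¬_; Dec; yes; no; ⌊_⌋)
open import Relation.Binary.PropositionalEquality
open import Data.Nat using (ℕ; zero; suc)
open import Data.Nat.Coprimality using (Coprime)
open import Data.List.Membership.Propositional using (_∈_)
open import Data.List.Relation.Unary.Any using (here; there)
open import Data.Rational using (ℚ; 0ℚ; 1ℚ)

module Cast where
  import Data.Nat as ℕ
  open import Data.Nat.Divisibility using (∣1⇒≡1)
  open import Data.Integer as ℤ using (+_)
  import Data.Integer.Properties as ℤ
  open import Data.Rational
  open import Data.Rational.Properties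
  open ≡-Reasoning

  ℕ→ℚ≡mkℚ : ∀ m → ℕ→ℚ m ≡ mkℚ (+ m) 0 (λ d → ∣1⇒≡1 (proj₂ d))
  ℕ→ℚ≡mkℚ m = normalize-coprime _

  ℕ→ℚ-+ : ∀ m k → ℕ→ℚ (m ℕ.+ k) ≡ ℕ→ℚ m + ℕ→ℚ k
  ℕ→ℚ-+ m k = sym (begin
    ℕ→ℚ m + ℕ→ℚ k                     ≡⟨ cong₂ _+_ (ℕ→ℚ≡mkℚ m) (ℕ→ℚ≡mkℚ k) ⟩
    (+ m ℤ.* + 1 ℤ.+ + k ℤ.* + 1) / 1  ≡⟨ cong (_/ 1) (cong₂ ℤ._+_ (ℤ.*-identityʳ (+ m)) (ℤ.*-identityʳ (+ k))) ⟩
    ℕ→ℚ (m ℕ.+ k)                      ∎)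

  ℕ→ℚ-* : ∀ m k → ℕ→ℚ (m ℕ.* k) ≡ ℕ→ℚ m * ℕ→ℚ k
  ℕ→ℚ-* m k = sym (begin
    ℕ→ℚ m * ℕ→ℚ k        ≡⟨ cong₂ _*_ (ℕ→ℚ≡mkℚ m) (ℕ→ℚ≡mkℚ k) ⟩
    (+ m ℤ.* + k) / 1     ≡⟨ cong (_/ 1) (sym (ℤ.pos-* m k)) ⟩
    ℕ→ℚ (m ℕ.* k)         ∎)

  ℕ→ℚ-^ : ∀ m i → ℕ→ℚ (m ℕ.^ i) ≡ powℚ (ℕ→ℚ m) i
  ℕ→ℚ-^ m zero    = refl
  ℕ→ℚ-^ m (suc i) = trans (ℕ→ℚ-* m (m ℕ.^ i)) (cong (ℕ→ℚ m *_) (ℕ→ℚ-^ m i))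

  ℕ→ℚ-mono-≤ : ∀ {m k} → m ℕ.≤ k → ℕ→ℚ m ≤ ℕ→ℚ k
  ℕ→ℚ-mono-≤ {m} {k} m≤k rewrite ℕ→ℚ≡mkℚ m | ℕ→ℚ≡mkℚ k = *≤* (ℤ.*-monoʳ-≤-nonNeg (+ 1) (ℤ.+≤+ m≤k))

  ℕ→ℚ-pos : ∀ {m} → 0 ℕ.< m → 0ℚ < ℕ→ℚ m
  ℕ→ℚ-pos {suc m} _ rewrite ℕ→ℚ≡mkℚ (suc m) = *<* (ℤ.+<+ (ℕ.s≤s ℕ.z≤n))

𝟙 : Bool → ℚ
𝟙 true  = 1ℚ
𝟙 false = 0ℚ

module Counting where
  open import Data.Nat
  open import Data.Nat.Properties
  open import Data.Nat.Divisibility using (_∣_; _∣?_; divides; ∣-trans; n∣m*n)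
  open import Data.Nat.Tactic.RingSolver using (solve-∀)
  open import Algebra.Properties.CommutativeSemigroup *-commutativeSemigroup using (x∙yz≈y∙xz)
  open import Function using (_⇔_; Equivalence; mk⇔)

  𝟙ℕ : Bool → ℕ
  𝟙ℕ true  = 1
  𝟙ℕ false = 0

  countUpTo : (ℕ → Bool) → ℕ → ℕ
  countUpTo g zero    = 0
  countUpTo g (suc m) = 𝟙ℕ (g (suc m)) + countUpTo g m

  countUpTo-+ : ∀ {f g h} → (∀ k → 𝟙ℕ (f k) + 𝟙ℕ (g k) ≡ 𝟙ℕ (h k)) →
                ∀ m → countUpTo f m + countUpTo g m ≡ countUpTo h m
  countUpTo-+ pointwise zero    = refl
  countUpTo-+ {f} {g} pointwise (suc m) = trans
    (interchange (𝟙ℕ (f (suc m))) (countUpTo f m) (𝟙ℕ (g (suc m))) (countUpTo g m))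
    (cong₂ _+_ (pointwise (suc m)) (countUpTo-+ pointwise m))
    where
    interchange : ∀ x y z w → (x + y) + (z + w) ≡ (x + z) + (y + w)
    interchange = solve-∀

  multiples : ℕ → ℕ → Bool
  multiples d k = ⌊ d ∣? k ⌋

  countUpTo-multiples : ∀ d .{{_ : NonZero d}} m →
                        countUpTo (multiples d) m * d ≤ m × m < suc (countUpTo (multiples d) m) * d
  countUpTo-multiples d zero = z≤n , subst (0 <_) (sym (+-identityʳ d)) (>-nonZero⁻¹ d)
  countUpTo-multiples d (suc m) with countUpTo-multiples d m | d ∣? suc m
  ... | lo , hi | no d∤1+m = m≤n⇒m≤1+n lo , ≤∧≢⇒< hi (d∤1+m ∘ divides (suc (countUpTo (multiples d) m)))
  ... | lo , hi | yes (divides q 1+m≡qd) =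
    ≤-reflexive (sym 1+m≡Ad) , subst (_< d + suc A * d) (sym 1+m≡Ad) (m<n+m (suc A * d) (>-nonZero⁻¹ d))
    where
    A = countUpTo (multiples d) m
    A<q : A < q
    A<q = *-cancelʳ-< d A q (≤-trans (s≤s lo) (≤-reflexive 1+m≡qd))
    1+m≡Ad : suc m ≡ suc A * d
    1+m≡Ad = ≤-antisym hi (≤-trans (*-monoˡ-≤ d A<q) (≤-reflexive (sym 1+m≡qd)))

  isYes-split : ∀ {S X Y : Set} (s? : Dec S) (x? : Dec X) (y? : Dec Y) →
                (Y → X) → S ⇔ (X × ¬ Y) → 𝟙ℕ ⌊ s? ⌋ + 𝟙ℕ ⌊ y? ⌋ ≡ 𝟙ℕ ⌊ x? ⌋
  isYes-split (yes s) (yes x) (yes y) _   S⇔ = ⊥-elim (proj₂ (Equivalence.to S⇔ s) y)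
  isYes-split (yes s) (yes x) (no ¬y) _   S⇔ = refl
  isYes-split (yes s) (no ¬x) _       _   S⇔ = ⊥-elim (¬x (proj₁ (Equivalence.to S⇔ s)))
  isYes-split (no ¬s) (yes x) (yes y) _   S⇔ = refl
  isYes-split (no ¬s) (yes x) (no ¬y) _   S⇔ = ⊥-elim (¬s (Equivalence.from S⇔ (x , ¬y)))
  isYes-split (no ¬s) (no ¬x) (yes y) Y⇒X S⇔ = ⊥-elim (¬x (Y⇒X y))
  isYes-split (no ¬s) (no ¬x) (no ¬y) _   S⇔ = refl

  subpowerᵇ≡isYes : ∀ b .{{_ : NonZero b}} i k → subpowerᵇ b i k ≡ ⌊ subpower? b i k ⌋
  subpowerᵇ≡isYes (suc b) i k = refl

  module _ (b : ℕ) .{{_ : NonZero b}} (i : ℕ) where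

    isSubpower⇔ : ∀ k → IsSubpower b i k ⇔ (b ^ i ∣ k × ¬ b ^ suc i ∣ k)
    isSubpower⇔ k = mk⇔ to from
      where
      m[bx]≡x[mb] : ∀ m b x → m * (b * x) ≡ x * (m * b)
      m[bx]≡x[mb] = solve-∀
      to : IsSubpower b i k → b ^ i ∣ k × ¬ b ^ suc i ∣ k
      to (l , k≡b^il , b∤l) = divides l (trans k≡b^il (*-comm (b ^ i) l)) , λ where
        (divides m k≡m[bb^i]) → b∤l (divides m (*-cancelˡ-≡ l (m * b) (b ^ i) {{m^n≢0 b i}}
          (trans (sym k≡b^il) (trans k≡m[bb^i] (m[bx]≡x[mb] m b (b ^ i))))))
      from : b ^ i ∣ k × ¬ b ^ suc i ∣ k → IsSubpower b i k
      from (divides q k≡qb^i , b^i+1∤k) = q , trans k≡qb^i (*-comm q (b ^ i)) , λ where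
        (divides r q≡rb) → b^i+1∤k (divides r (trans k≡qb^i (trans (cong (_* b ^ i) q≡rb) (*-assoc r b (b ^ i)))))

    countUpTo-subpowers : ∀ m → countUpTo (subpowerᵇ b i) m + countUpTo (multiples (b ^ suc i)) m
                                ≡ countUpTo (multiples (b ^ i)) m
    countUpTo-subpowers = countUpTo-+ λ k → trans
      (cong (λ s → 𝟙ℕ s + 𝟙ℕ ⌊ b ^ suc i ∣? k ⌋) (subpowerᵇ≡isYes b i k))
      (isYes-split (subpower? b i k) (b ^ i ∣? k) (b ^ suc i ∣? k) (∣-trans (n∣m*n b)) (isSubpower⇔ k))

  n<[1+m]^n : ∀ m n → 0 < m → n < suc m ^ n
  n<[1+m]^n m zero    _   = s≤s z≤n
  n<[1+m]^n m (suc n) 0<m =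
    ≤-trans (≤-reflexive (+-comm 1 (suc n))) (+-mono-≤ (n<[1+m]^n m n 0<m) (*-mono-≤ 0<m (m^n>0 (suc m) n)))

  -- With A = ⌊ n / d ⌋ and B = ⌊ n / b d ⌋, c = A - B is within one of (b - 1) n / b d.
  floor-difference-bounds : ∀ {b₁ d n A B c} → let b = suc b₁ in
    A * d ≤ n → n < suc A * d → B * (b * d) ≤ n → n < suc B * (b * d) → c + B ≡ A →
    c * (b * d) ≤ b₁ * n + b * d × b₁ * n ≤ c * (b * d) + b * d
  floor-difference-bounds {b₁} {d} {n} {A} {B} {c} Ad≤n n<[1+A]d BK≤n n<[1+B]K c+B≡A =
    <⇒≤ (+-cancelʳ-< (B * K) (c * K) (b₁ * n + K) upper) ,
    <⇒≤ (+-cancelʳ-< n (b₁ * n) (c * K + K) lower)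
    where
    open ≤-Reasoning
    b = suc b₁
    K = b * d
    AK≡cK+BK : A * K ≡ c * K + B * K
    AK≡cK+BK = trans (cong (_* K) (sym c+B≡A)) (*-distribʳ-+ K c B)
    AK≡b[Ad] : A * K ≡ b * (A * d)
    AK≡b[Ad] = x∙yz≈y∙xz A b d
    rearrange₁ : ∀ B K b₁n → suc B * K + b₁n ≡ (b₁n + K) + B * K
    rearrange₁ = solve-∀
    rearrange₂ : ∀ d Ad b₁ → suc b₁ * (d + Ad) ≡ suc b₁ * d + suc b₁ * Ad
    rearrange₂ = solve-∀
    rearrange₃ : ∀ K cK BK → K + (cK + BK) ≡ (cK + K) + BK
    rearrange₃ = solve-∀
    upper : c * K + B * K < (b₁ * n + K) + B * K
    upper = begin-strict
      c * K + B * K       ≡⟨ sym AK≡cK+BK ⟩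
      A * K               ≡⟨ AK≡b[Ad] ⟩
      b * (A * d)         ≤⟨ *-monoʳ-≤ b Ad≤n ⟩
      n + b₁ * n          <⟨ +-monoˡ-< (b₁ * n) n<[1+B]K ⟩
      suc B * K + b₁ * n  ≡⟨ rearrange₁ B K (b₁ * n) ⟩
      (b₁ * n + K) + B * K ∎
    lower : b₁ * n + n < (c * K + K) + n
    lower = begin-strict
      b₁ * n + n            ≡⟨ +-comm (b₁ * n) n ⟩
      b * n                 <⟨ *-monoʳ-< b n<[1+A]d ⟩
      b * (d + A * d)       ≡⟨ rearrange₂ d (A * d) b₁ ⟩
      K + b * (A * d)       ≡⟨ cong (K +_) (trans (sym AK≡b[Ad]) AK≡cK+BK) ⟩
      K + (c * K + B * K)   ≡⟨ rearrange₃ K (c * K) (B * K) ⟩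
      (c * K + K) + B * K   ≤⟨ +-monoʳ-≤ (c * K + K) BK≤n ⟩
      (c * K + K) + n ∎

  subpowerCount-bounds : ∀ b₁ i n → let b = suc b₁ ; c = countUpTo (subpowerᵇ b i) n in
    c * b ^ suc i ≤ b₁ * n + b ^ suc i × b₁ * n ≤ c * b ^ suc i + b ^ suc i
  subpowerCount-bounds b₁ i n =
    floor-difference-bounds {b₁} {suc b₁ ^ i} {n} {A} {B} {c} (proj₁ multiples-b^i) (proj₂ multiples-b^i)
                            (proj₁ multiples-b^i+1) (proj₂ multiples-b^i+1)
                            (countUpTo-subpowers (suc b₁) i n)
    where
    A = countUpTo (multiples (suc b₁ ^ i)) n
    B = countUpTo (multiples (suc b₁ ^ suc i)) n
    c = countUpTo (subpowerᵇ (suc b₁) i) n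
    multiples-b^i = countUpTo-multiples (suc b₁ ^ i) {{m^n≢0 (suc b₁) i}} n
    multiples-b^i+1 = countUpTo-multiples (suc b₁ ^ suc i) {{m^n≢0 (suc b₁) (suc i)}} n

module Sums where
  open import Data.Bool.Properties using () renaming (_≟_ to _≟ᵇ_)
  open import Data.List.Properties using (map-++)
  open import Data.Rational
  open import Data.Rational.Properties using (+-identityˡ; +-identityʳ; +-assoc; +-comm; *-zeroʳ; *-distribˡ-+)
  open Cast
  open Counting using (𝟙ℕ; countUpTo)
  open ≡-Reasoning

  sumℚ-++ : ∀ xs ys → sumℚ (xs ++ ys) ≡ sumℚ xs + sumℚ ys
  sumℚ-++ []       ys = sym (+-identityˡ (sumℚ ys))
  sumℚ-++ (x ∷ xs) ys = trans (cong (x +_) (sumℚ-++ xs ys)) (sym (+-assoc x (sumℚ xs) (sumℚ ys)))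

  sumℚ-*ˡ : ∀ c xs → sumℚ (map (c *_) xs) ≡ c * sumℚ xs
  sumℚ-*ˡ c []       = sym (*-zeroʳ c)
  sumℚ-*ˡ c (x ∷ xs) = trans (cong (c * x +_) (sumℚ-*ˡ c xs)) (sym (*-distribˡ-+ c x (sumℚ xs)))

  𝟙-∧ : ∀ x y → 𝟙 (x ∧ y) ≡ 𝟙 x * 𝟙 y
  𝟙-∧ true  true  = refl
  𝟙-∧ true  false = refl
  𝟙-∧ false true  = refl
  𝟙-∧ false false = refl

  𝟙-if-not : ∀ x y → 𝟙 (if x then not y else true) ≡ 1ℚ - 𝟙 x * 𝟙 y
  𝟙-if-not true  true  = refl
  𝟙-if-not true  false = refl
  𝟙-if-not false true  = refl
  𝟙-if-not false false = refl

  𝟙≡ℕ→ℚ𝟙ℕ : ∀ x → 𝟙 x ≡ ℕ→ℚ (𝟙ℕ x)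
  𝟙≡ℕ→ℚ𝟙ℕ true  = refl
  𝟙≡ℕ→ℚ𝟙ℕ false = refl

  sumℚ-countUpTo : ∀ g m → sumℚ (map (𝟙 ∘ g) (range1 m)) ≡ ℕ→ℚ (countUpTo g m)
  sumℚ-countUpTo g zero    = refl
  sumℚ-countUpTo g (suc m) = begin
    sumℚ (map (𝟙 ∘ g) (range1 m ++ suc m ∷ []))
      ≡⟨ cong sumℚ (map-++ (𝟙 ∘ g) (range1 m) (suc m ∷ [])) ⟩
    sumℚ (map (𝟙 ∘ g) (range1 m) ++ 𝟙 (g (suc m)) ∷ [])
      ≡⟨ sumℚ-++ (map (𝟙 ∘ g) (range1 m)) (𝟙 (g (suc m)) ∷ []) ⟩
    sumℚ (map (𝟙 ∘ g) (range1 m)) + (𝟙 (g (suc m)) + 0ℚ)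
      ≡⟨ cong₂ _+_ (sumℚ-countUpTo g m) (trans (+-identityʳ (𝟙 (g (suc m)))) (𝟙≡ℕ→ℚ𝟙ℕ (g (suc m)))) ⟩
    ℕ→ℚ (countUpTo g m) + ℕ→ℚ (𝟙ℕ (g (suc m)))
      ≡⟨ +-comm (ℕ→ℚ (countUpTo g m)) (ℕ→ℚ (𝟙ℕ (g (suc m)))) ⟩
    ℕ→ℚ (𝟙ℕ (g (suc m))) + ℕ→ℚ (countUpTo g m)
      ≡⟨ sym (ℕ→ℚ-+ (𝟙ℕ (g (suc m))) (countUpTo g m)) ⟩
    ℕ→ℚ (countUpTo g (suc m)) ∎

  length-filter : ∀ {A : Set} (g : A → Bool) xs →
                  ℕ→ℚ (length (filter (λ x → g x ≟ᵇ true) xs)) ≡ sumℚ (map (𝟙 ∘ g) xs)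
  length-filter g []       = refl
  length-filter g (x ∷ xs) with g x
  ... | true  = trans (ℕ→ℚ-+ 1 (length (filter (λ x → g x ≟ᵇ true) xs))) (cong (1ℚ +_) (length-filter g xs))
  ... | false = trans (length-filter g xs) (sym (+-identityˡ (sumℚ (map (𝟙 ∘ g) xs))))

DependsOnFirst : {B : Set} → ℕ → (List Bool → B) → Set
DependsOnFirst k f = ∀ S S′ → take k S ≡ take k S′ → f S ≡ f S′

module Prefix where
  open import Data.Nat using (_≤_; s≤s)
  open import Data.Nat.Properties using (m≤n⇒m⊓n≡m)
  open import Data.List.Properties using (take-take)

  take-≤ : ∀ {k k′} → k ≤ k′ → (S : List Bool) → take k (take k′ S) ≡ take k S
  take-≤ {k} {k′} k≤k′ S = trans (take-take k k′ S) (cong (λ m → take m S) (m≤n⇒m⊓n≡m k≤k′))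

  dependsOnFirst-mono : ∀ {B : Set} {k k′} {f : List Bool → B} → k ≤ k′ →
                        DependsOnFirst k f → DependsOnFirst k′ f
  dependsOnFirst-mono k≤k′ dep S S′ e =
    dep S S′ (trans (sym (take-≤ k≤k′ S)) (trans (cong (take _) e) (take-≤ k≤k′ S′)))

  dependsOnFirst-∘ : ∀ {B C : Set} {k} (g : B → C) {f} → DependsOnFirst k f → DependsOnFirst k (g ∘ f)
  dependsOnFirst-∘ g dep S S′ e = cong g (dep S S′ e)

  dependsOnFirst-zip : ∀ {A B C : Set} {k} (_∙_ : A → B → C) {f g} →
                       DependsOnFirst k f → DependsOnFirst k g → DependsOnFirst k (λ S → f S ∙ g S)
  dependsOnFirst-zip _∙_ depf depg S S′ e = cong₂ _∙_ (depf S S′ e) (depg S S′ e)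

  dependsOnFirst-≗ : ∀ {B : Set} {k} {f g : List Bool → B} → (∀ S → f S ≡ g S) →
                     DependsOnFirst k g → DependsOnFirst k f
  dependsOnFirst-≗ f≗g dep S S′ e = trans (f≗g S) (trans (dep S S′ e) (sym (f≗g S′)))

  mem-take : ∀ {u k} S → u ≤ k → mem (take k S) u ≡ mem S u
  mem-take {zero}        S       _         = refl
  mem-take {suc u}       []      (s≤s _)   = refl
  mem-take {suc zero}    (x ∷ S) (s≤s _)   = refl
  mem-take {suc (suc u)} (x ∷ S) (s≤s u<k) = mem-take S u<k

  mem-dependsOnFirst : ∀ {u k} → u ≤ k → DependsOnFirst k (λ S → mem S u)
  mem-dependsOnFirst {u} u≤k S S′ e =
    trans (sym (mem-take S u≤k)) (trans (cong (λ T → mem T u) e) (mem-take S′ u≤k))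

module Expectation (p : ℚ) where
  open import Data.Nat as ℕ using (s≤s; z≤n)
  open import Data.List.Properties using (map-++; map-∘; map-cong)
  open import Data.Rational
  open import Data.Rational.Properties using (+-identityʳ; *-identityˡ; *-zeroˡ; *-assoc)
  open import Data.Rational.Solver using (module +-*-Solver)
  open +-*-Solver
  open Sums
  open ≡-Reasoning

  𝔼 : ℕ → (List Bool → ℚ) → ℚ
  𝔼 zero    f = f []
  𝔼 (suc n) f = p * 𝔼 n (f ∘ (true ∷_)) + (1ℚ - p) * 𝔼 n (f ∘ (false ∷_))

  weightedSum≡𝔼 : ∀ n f → sumℚ (map (λ S → prob p S * f S) (allSubsets n)) ≡ 𝔼 n f
  weightedSum≡𝔼 zero    f = trans (+-identityʳ _) (*-identityˡ _)
  weightedSum≡𝔼 (suc n) f = begin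
    sumℚ (map w (map (true ∷_) Ss ++ map (false ∷_) Ss))
      ≡⟨ cong sumℚ (map-++ w (map (true ∷_) Ss) (map (false ∷_) Ss)) ⟩
    sumℚ (map w (map (true ∷_) Ss) ++ map w (map (false ∷_) Ss))
      ≡⟨ sumℚ-++ (map w (map (true ∷_) Ss)) (map w (map (false ∷_) Ss)) ⟩
    sumℚ (map w (map (true ∷_) Ss)) + sumℚ (map w (map (false ∷_) Ss))
      ≡⟨ cong₂ _+_ (branch true p (λ _ → refl)) (branch false (1ℚ - p) (λ _ → refl)) ⟩
    𝔼 (suc n) f ∎
    where
    Ss = allSubsets n
    w  = λ S → prob p S * f S
    branch : ∀ x q → (∀ S → prob p (x ∷ S) ≡ q * prob p S) →
             sumℚ (map w (map (x ∷_) Ss)) ≡ q * 𝔼 n (f ∘ (x ∷_))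
    branch x q prob-x∷ = begin
      sumℚ (map w (map (x ∷_) Ss))
        ≡⟨ cong sumℚ (trans (sym (map-∘ Ss)) (trans (map-cong factor Ss) (map-∘ Ss))) ⟩
      sumℚ (map (q *_) (map (λ S → prob p S * f (x ∷ S)) Ss))
        ≡⟨ sumℚ-*ˡ q (map (λ S → prob p S * f (x ∷ S)) Ss) ⟩
      q * sumℚ (map (λ S → prob p S * f (x ∷ S)) Ss)
        ≡⟨ cong (q *_) (weightedSum≡𝔼 n (f ∘ (x ∷_))) ⟩
      q * 𝔼 n (f ∘ (x ∷_)) ∎
      where
      factor : ∀ S → w (x ∷ S) ≡ q * (prob p S * f (x ∷ S))
      factor S = trans (cong (_* f (x ∷ S)) (prob-x∷ S)) (*-assoc q (prob p S) (f (x ∷ S)))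

  𝔼-cong : ∀ n {f g} → (∀ S → f S ≡ g S) → 𝔼 n f ≡ 𝔼 n g
  𝔼-cong zero    f≗g = f≗g []
  𝔼-cong (suc n) f≗g = cong₂ (λ x y → p * x + (1ℚ - p) * y)
    (𝔼-cong n (f≗g ∘ (true ∷_))) (𝔼-cong n (f≗g ∘ (false ∷_)))

  𝔼-const : ∀ n c → 𝔼 n (λ _ → c) ≡ c
  𝔼-const zero    c = refl
  𝔼-const (suc n) c rewrite 𝔼-const n c =
    solve 2 (λ p c → p :* c :+ (con 1ℚ :- p) :* c := c) refl p c

  𝔼-+ : ∀ n f g → 𝔼 n (λ S → f S + g S) ≡ 𝔼 n f + 𝔼 n g
  𝔼-+ zero    f g = refl
  𝔼-+ (suc n) f g
    rewrite 𝔼-+ n (f ∘ (true ∷_)) (g ∘ (true ∷_)) | 𝔼-+ n (f ∘ (false ∷_)) (g ∘ (false ∷_)) =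
    solve 5 (λ p a b c d → p :* (a :+ b) :+ (con 1ℚ :- p) :* (c :+ d)
                         := (p :* a :+ (con 1ℚ :- p) :* c) :+ (p :* b :+ (con 1ℚ :- p) :* d))
            refl p _ _ _ _

  𝔼-const-minus : ∀ n c f → 𝔼 n (λ S → c - f S) ≡ c - 𝔼 n f
  𝔼-const-minus zero    c f = refl
  𝔼-const-minus (suc n) c f
    rewrite 𝔼-const-minus n c (f ∘ (true ∷_)) | 𝔼-const-minus n c (f ∘ (false ∷_)) =
    solve 4 (λ p c a b → p :* (c :- a) :+ (con 1ℚ :- p) :* (c :- b)
                       := c :- (p :* a :+ (con 1ℚ :- p) :* b))
            refl p c _ _

  𝔼-sumℚ : ∀ n {A : Set} (f : List Bool → A → ℚ) (xs : List A) →
           𝔼 n (λ S → sumℚ (map (f S) xs)) ≡ sumℚ (map (λ x → 𝔼 n (λ S → f S x)) xs)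
  𝔼-sumℚ n f []       = 𝔼-const n 0ℚ
  𝔼-sumℚ n f (x ∷ xs) = trans (𝔼-+ n (λ S → f S x) (λ S → sumℚ (map (f S) xs)))
                              (cong (𝔼 n (λ S → f S x) +_) (𝔼-sumℚ n f xs))

  𝔼-dependsOnFirst-0 : ∀ n {f} → DependsOnFirst 0 f → 𝔼 n f ≡ f []
  𝔼-dependsOnFirst-0 n {f} dep = trans (𝔼-cong n (λ S → dep S [] refl)) (𝔼-const n (f []))

  𝔼-independent : ∀ {u n f} → 0 ℕ.< u → u ℕ.≤ n → DependsOnFirst (ℕ.pred u) f →
                  𝔼 n (λ S → 𝟙 (mem S u) * f S) ≡ p * 𝔼 n f
  𝔼-independent {suc zero} {suc n} {f} _ _ dep = begin
    p * 𝔼 n (λ S → 1ℚ * f (true ∷ S)) + (1ℚ - p) * 𝔼 n (λ S → 0ℚ * f (false ∷ S))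
      ≡⟨ cong₂ (λ x y → p * x + (1ℚ - p) * y)
               (trans (𝔼-cong n (λ S → *-identityˡ (f (true ∷ S))))
                      (trans (𝔼-dependsOnFirst-0 n (λ S S′ _ → dep _ _ refl)) (dep _ _ refl)))
               (trans (𝔼-cong n (λ S → *-zeroˡ (f (false ∷ S)))) (𝔼-const n 0ℚ)) ⟩
    p * f [] + (1ℚ - p) * 0ℚ
      ≡⟨ solve 2 (λ p c → p :* c :+ (con 1ℚ :- p) :* con 0ℚ := p :* c) refl p (f []) ⟩
    p * f []
      ≡⟨ cong (p *_) (sym (𝔼-dependsOnFirst-0 (suc n) dep)) ⟩
    p * 𝔼 (suc n) f ∎
  𝔼-independent {suc (suc k)} {suc n} {f} _ (s≤s k<n) dep = begin
    p * 𝔼 n (λ S → 𝟙 (mem S (suc k)) * f (true ∷ S)) + (1ℚ - p) * 𝔼 n (λ S → 𝟙 (mem S (suc k)) * f (false ∷ S))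
      ≡⟨ cong₂ (λ x y → p * x + (1ℚ - p) * y)
               (𝔼-independent (s≤s z≤n) k<n (λ S S′ e → dep _ _ (cong (true ∷_) e)))
               (𝔼-independent (s≤s z≤n) k<n (λ S S′ e → dep _ _ (cong (false ∷_) e))) ⟩
    p * (p * 𝔼 n (f ∘ (true ∷_))) + (1ℚ - p) * (p * 𝔼 n (f ∘ (false ∷_)))
      ≡⟨ solve 3 (λ p a b → p :* (p :* a) :+ (con 1ℚ :- p) :* (p :* b) := p :* (p :* a :+ (con 1ℚ :- p) :* b))
               refl p (𝔼 n (f ∘ (true ∷_))) (𝔼 n (f ∘ (false ∷_))) ⟩
    p * 𝔼 (suc n) f ∎

module Search {A : Set} (P : A → Bool) where

  findᵇ-unfold : (F : List A → Maybe A) → F [] ≡ nothing →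
                 (∀ x xs → F (x ∷ xs) ≡ (if P x then just x else F xs)) →
                 ∀ xs → F xs ≡ findᵇ P xs
  findᵇ-unfold F F[] F∷ []       = F[]
  findᵇ-unfold F F[] F∷ (x ∷ xs) rewrite F∷ x xs | findᵇ-unfold F F[] F∷ xs = refl

  findᵇ-none : (∀ x → P x ≡ false) → ∀ xs → findᵇ P xs ≡ nothing
  findᵇ-none none []       = refl
  findᵇ-none none (x ∷ xs) rewrite none x = findᵇ-none none xs

  findᵇ-unique : ∀ {x xs} → x ∈ xs → P x ≡ true → (∀ y → P y ≡ true → y ≡ x) → findᵇ P xs ≡ just x
  findᵇ-unique (here refl) Px unique rewrite Px = refl
  findᵇ-unique {xs = y ∷ _} (there x∈xs) Px unique with P y in Py
  ... | true  = cong just (unique y Py)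
  ... | false = findᵇ-unique x∈xs Px unique

module Basic where
  open import Data.Nat using (_<_; _≤_; s≤s; z≤n)
  open import Data.Nat.Properties using (≤-refl; <⇒≱; m≤n⇒m<n∨m≡n; m≤n⇒m≤1+n; ≤-pred)
  open import Data.List.Properties using (map-++)
  open import Data.Sum using (inj₁; inj₂)
  open import Data.List.Membership.Propositional.Properties using (∈-++⁺ˡ; ∈-++⁺ʳ)
  open ≡-Reasoning

  evenᵇ-suc : ∀ d → evenᵇ (suc d) ≡ not (evenᵇ d)
  evenᵇ-suc zero          = refl
  evenᵇ-suc (suc zero)    = refl
  evenᵇ-suc (suc (suc d)) = evenᵇ-suc d

  mem-positive : ∀ S {u} → mem S u ≡ true → 0 < u
  mem-positive S {suc u} _ = s≤s z≤n

  range1-∈ : ∀ {n u} → 0 < u → u ≤ n → u ∈ range1 n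
  range1-∈ {zero}  0<u u≤0 = ⊥-elim (<⇒≱ 0<u u≤0)
  range1-∈ {suc n} 0<u u≤1+n with m≤n⇒m<n∨m≡n u≤1+n
  ... | inj₁ u<1+n = ∈-++⁺ˡ (range1-∈ 0<u (≤-pred u<1+n))
  ... | inj₂ refl  = ∈-++⁺ʳ (range1 n) (here refl)

  map-range1-cong : ∀ {A : Set} {f g : ℕ → A} m → (∀ v → 0 < v → v ≤ m → f v ≡ g v) →
                    map f (range1 m) ≡ map g (range1 m)
  map-range1-cong zero           _   = refl
  map-range1-cong {f = f} {g} (suc m) f≗g = begin
    map f (range1 m ++ suc m ∷ [])
      ≡⟨ map-++ f (range1 m) (suc m ∷ []) ⟩
    map f (range1 m) ++ f (suc m) ∷ []
      ≡⟨ cong₂ _++_ (map-range1-cong m (λ v 0<v v≤m → f≗g v 0<v (m≤n⇒m≤1+n v≤m)))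
                    (cong (_∷ []) (f≗g (suc m) (s≤s z≤n) ≤-refl)) ⟩
    map g (range1 m) ++ g (suc m) ∷ []
      ≡⟨ sym (map-++ g (range1 m) (suc m ∷ [])) ⟩
    map g (range1 m ++ suc m ∷ []) ∎

module EvenProbability where
  open import Data.Rational
  open import Data.Rational.Properties
  open import Data.Rational.Solver using (module +-*-Solver)
  open +-*-Solver

  evenProbability : ℚ → ℕ → ℚ
  evenProbability p zero    = 1ℚ
  evenProbability p (suc j) = 1ℚ - p * evenProbability p j

  evenProbability-closedForm : ∀ p j → evenProbability p j * (1ℚ + p) ≡ 1ℚ + powℚ (- p) j * p
  evenProbability-closedForm p zero    = solve 1 (λ p → con 1ℚ :* (con 1ℚ :+ p) := con 1ℚ :+ con 1ℚ :* p) refl p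
  evenProbability-closedForm p (suc j) = begin
    (1ℚ - p * s) * (1ℚ + p)                 ≡⟨ solve 2 (λ p s → (con 1ℚ :- p :* s) :* (con 1ℚ :+ p)
                                                             := (con 1ℚ :+ p) :- p :* (s :* (con 1ℚ :+ p))) refl p s ⟩
    (1ℚ + p) - p * (s * (1ℚ + p))           ≡⟨ cong (λ z → (1ℚ + p) - p * z) (evenProbability-closedForm p j) ⟩
    (1ℚ + p) - p * (1ℚ + powℚ (- p) j * p)  ≡⟨ solve 2 (λ p P → (con 1ℚ :+ p) :- p :* (con 1ℚ :+ P :* p)
                                                             := con 1ℚ :+ ((:- p) :* P) :* p) refl p (powℚ (- p) j) ⟩
    1ℚ + (- p * powℚ (- p) j) * p           ∎
    where
    open ≡-Reasoning
    s = evenProbability p j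

  ∈[0,1] : ℚ → Set
  ∈[0,1] x = 0ℚ ≤ x × x ≤ 1ℚ

  *-∈[0,1] : ∀ {x y} → ∈[0,1] x → ∈[0,1] y → ∈[0,1] (x * y)
  *-∈[0,1] {x} {y} (0≤x , x≤1) (0≤y , y≤1) =
    ≤-trans (≤-reflexive (sym (*-zeroˡ y))) (*-monoʳ-≤-nonNeg y {{nonNegative 0≤y}} 0≤x) ,
    ≤-trans (*-monoʳ-≤-nonNeg y {{nonNegative 0≤y}} x≤1) (≤-trans (≤-reflexive (*-identityˡ y)) y≤1)

  1-∈[0,1] : ∀ {x} → ∈[0,1] x → ∈[0,1] (1ℚ - x)
  1-∈[0,1] (0≤x , x≤1) =
    ≤-trans (≤-reflexive (sym (+-inverseʳ 1ℚ))) (+-monoʳ-≤ 1ℚ (neg-antimono-≤ x≤1)) ,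
    ≤-trans (+-monoʳ-≤ 1ℚ (neg-antimono-≤ 0≤x)) (≤-reflexive (+-identityʳ 1ℚ))

  evenProbability-∈[0,1] : ∀ {p} → ∈[0,1] p → ∀ j → ∈[0,1] (evenProbability p j)
  evenProbability-∈[0,1] p∈ zero    = nonNegative⁻¹ 1ℚ , ≤-refl
  evenProbability-∈[0,1] p∈ (suc j) = 1-∈[0,1] (*-∈[0,1] p∈ (evenProbability-∈[0,1] p∈ j))

module Distance (p : ℚ) (a b n : ℕ) (0<a : 0 Data.Nat.< a) (a<b : a Data.Nat.< b) (coprime : Coprime b a) where
  open import Data.Nat as ℕ using (_<_; _≤_; _*_; _^_; pred; s≤s; z≤n; NonZero; >-nonZero; _≟_)
  open import Data.Nat.Properties
  open import Data.Nat.Divisibility using (_∣_; _∣?_; divides; _∣0)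
  open import Data.Nat.Coprimality using (coprime-divisor)
  open import Algebra.Properties.CommutativeSemigroup *-commutativeSemigroup using (x∙yz≈y∙xz)
  open import Data.Rational using (_-_) renaming (_*_ to _*ℚ_)
  open import Relation.Nullary.Decidable using (dec-true; isYes≗does)
  open Basic
  open Sums using (𝟙-if-not)
  open Prefix
  open Expectation p
  open EvenProbability

  isInNeighbour : List Bool → ℕ → ℕ → Bool
  isInNeighbour S v u = mem S u ∧ ⌊ b * u ≟ a * v ⌋

  -- findPred searches with a local loop, which can only be named by unification against the goal.
  findPred≡findᵇ : ∀ S v → findPred a b n S v ≡ findᵇ (isInNeighbour S v) (range1 n)
  findPred≡findᵇ S v with range1 n | Search.findᵇ-unfold (isInNeighbour S v) _ refl (λ _ _ → refl)
  ... | us | loop≡findᵇ = loop≡findᵇ us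

  instance
    b≢0 : NonZero b
    b≢0 = >-nonZero (<-trans 0<a a<b)

  isInNeighbour-sound : ∀ S v u → isInNeighbour S v u ≡ true → mem S u ≡ true × b * u ≡ a * v
  isInNeighbour-sound S v u h with mem S u | b * u ≟ a * v
  ... | true | yes bu≡av = refl , bu≡av

  findPred-nonMultiple : ∀ S v → ¬ b ∣ v → findPred a b n S v ≡ nothing
  findPred-nonMultiple S v b∤v =
    trans (findPred≡findᵇ S v) (Search.findᵇ-none (isInNeighbour S v) none (range1 n))
    where
    none : ∀ u → isInNeighbour S v u ≡ false
    none u with isInNeighbour S v u in h
    ... | false = refl
    ... | true  = ⊥-elim (b∤v (coprime-divisor coprime (divides u (trans (sym bu≡av) (*-comm b u)))))
      where bu≡av = proj₂ (isInNeighbour-sound S v u h)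

  inNeighbour-of-multiple : ∀ S w u → isInNeighbour S (b * w) u ≡ true → u ≡ a * w
  inNeighbour-of-multiple S w u h =
    *-cancelˡ-≡ u (a * w) b (trans (proj₂ (isInNeighbour-sound S (b * w) u h)) (sym (x∙yz≈y∙xz b a w)))

  findPred-multiple : ∀ S w → b * w ≤ n →
                      findPred a b n S (b * w) ≡ (if mem S (a * w) then just (a * w) else nothing)
  findPred-multiple S w bw≤n with mem S (a * w) in aw∈S
  ... | true  = trans (findPred≡findᵇ S (b * w))
                  (Search.findᵇ-unique (isInNeighbour S (b * w)) aw∈range isInNeighbour-aw (inNeighbour-of-multiple S w))
    where
    aw∈range = range1-∈ (mem-positive S aw∈S) (≤-trans (*-monoˡ-≤ w (<⇒≤ a<b)) bw≤n)
    isInNeighbour-aw : isInNeighbour S (b * w) (a * w) ≡ true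
    isInNeighbour-aw rewrite aw∈S =
      trans (isYes≗does (b * (a * w) ≟ a * (b * w))) (dec-true (b * (a * w) ≟ a * (b * w)) (x∙yz≈y∙xz b a w))
  ... | false = trans (findPred≡findᵇ S (b * w)) (Search.findᵇ-none (isInNeighbour S (b * w)) none (range1 n))
    where
    none : ∀ u → isInNeighbour S (b * w) u ≡ false
    none u with isInNeighbour S (b * w) u in h
    ... | false = refl
    ... | true with refl ← inNeighbour-of-multiple S w u h
      with () ← trans (sym (proj₁ (isInNeighbour-sound S (b * w) (a * w) h))) aw∈S

  atEvenDistance : List Bool → ℕ → ℕ → Bool
  atEvenDistance S f v = evenᵇ (distFrom a b n S f v)

  distFrom-nonMultiple : ∀ S f v → ¬ b ∣ v → distFrom a b n S f v ≡ 0
  distFrom-nonMultiple S zero    v _   = refl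
  distFrom-nonMultiple S (suc f) v b∤v rewrite findPred-nonMultiple S v b∤v = refl

  atEvenDistance-multiple : ∀ S f w → b * w ≤ n →
    atEvenDistance S (suc f) (b * w) ≡ (if mem S (a * w) then not (atEvenDistance S f (a * w)) else true)
  atEvenDistance-multiple S f w bw≤n rewrite findPred-multiple S w bw≤n with mem S (a * w)
  ... | true  = evenᵇ-suc (distFrom a b n S f (a * w))
  ... | false = refl

  a*w≤pred[b*w] : ∀ w → a * w ≤ pred (b * w)
  a*w≤pred[b*w] zero    rewrite *-zeroʳ a = z≤n
  a*w≤pred[b*w] (suc w) = suc[m]≤n⇒m≤pred[n] (*-monoˡ-< (suc w) a<b)

  atEvenDistance-dependsOnFirst : ∀ f v → v ≤ n → DependsOnFirst (pred v) (λ S → atEvenDistance S f v)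
  atEvenDistance-dependsOnFirst zero    v _ _ _ _ = refl
  atEvenDistance-dependsOnFirst (suc f) v v≤n with b ∣? v
  ... | no b∤v = λ S S′ _ →
    cong evenᵇ (trans (distFrom-nonMultiple S (suc f) v b∤v) (sym (distFrom-nonMultiple S′ (suc f) v b∤v)))
  ... | yes (divides w v≡wb) =
    subst (λ v → DependsOnFirst (pred v) (λ S → atEvenDistance S (suc f) v)) bw≡v
      (dependsOnFirst-≗ (λ S → atEvenDistance-multiple S f w bw≤n)
        (dependsOnFirst-zip (λ x y → if x then not y else true)
          (mem-dependsOnFirst (a*w≤pred[b*w] w))
          (dependsOnFirst-mono (pred-mono-≤ aw≤bw)
            (atEvenDistance-dependsOnFirst f (a * w) (≤-trans aw≤bw bw≤n)))))
    where
    bw≡v = trans (*-comm b w) (sym v≡wb)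
    bw≤n = subst (_≤ n) (sym bw≡v) v≤n
    aw≤bw = *-monoˡ-≤ w (<⇒≤ a<b)

  ∤⇒0< : ∀ {l} → ¬ b ∣ l → 0 < l
  ∤⇒0< {zero}  b∤0 = ⊥-elim (b∤0 (b ∣0))
  ∤⇒0< {suc _} _   = s≤s z≤n

  𝔼-atEvenDistance : ∀ j l f → ¬ b ∣ l → b ^ j * l ≤ n → j ≤ f →
                     𝔼 n (λ S → 𝟙 (atEvenDistance S f (b ^ j * l))) ≡ evenProbability p j
  𝔼-atEvenDistance zero l f b∤l _ _ =
    trans (𝔼-cong n (λ S → cong (𝟙 ∘ evenᵇ) (distFrom-nonMultiple S f (1 * l) b∤1*l))) (𝔼-const n 1ℚ)
    where b∤1*l = subst (¬_ ∘ (b ∣_)) (sym (*-identityˡ l)) b∤l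
  𝔼-atEvenDistance (suc j) l (suc f) b∤l v≤n (s≤s j≤f) = begin
    𝔼 n (λ S → 𝟙 (atEvenDistance S (suc f) (b ^ suc j * l)))
      ≡⟨ 𝔼-cong n (λ S → trans (cong (λ v → 𝟙 (atEvenDistance S (suc f) v)) (*-assoc b (b ^ j) l))
                        (trans (cong 𝟙 (atEvenDistance-multiple S f w bw≤n))
                               (𝟙-if-not (mem S (a * w)) (atEvenDistance S f (a * w))))) ⟩
    𝔼 n (λ S → 1ℚ - 𝟙 (mem S (a * w)) *ℚ 𝟙 (atEvenDistance S f (a * w)))
      ≡⟨ 𝔼-const-minus n 1ℚ _ ⟩
    1ℚ - 𝔼 n (λ S → 𝟙 (mem S (a * w)) *ℚ 𝟙 (atEvenDistance S f (a * w)))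
      ≡⟨ cong (1ℚ -_) (𝔼-independent 0<aw aw≤n (dependsOnFirst-∘ 𝟙 (atEvenDistance-dependsOnFirst f (a * w) aw≤n))) ⟩
    1ℚ - p *ℚ 𝔼 n (λ S → 𝟙 (atEvenDistance S f (a * w)))
      ≡⟨ cong (λ x → 1ℚ - p *ℚ x) (subst (λ u → 𝔼 n (λ S → 𝟙 (atEvenDistance S f u)) ≡ evenProbability p j)
               (sym aw≡b^j[al])
               (𝔼-atEvenDistance j (a * l) f (b∤l ∘ coprime-divisor coprime) (subst (_≤ n) aw≡b^j[al] aw≤n) j≤f)) ⟩
    evenProbability p (suc j) ∎
    where
    open ≡-Reasoning
    w = b ^ j * l
    bw≤n : b * w ≤ n
    bw≤n = subst (_≤ n) (*-assoc b (b ^ j) l) v≤n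
    aw≤n : a * w ≤ n
    aw≤n = ≤-trans (*-monoˡ-≤ w (<⇒≤ a<b)) bw≤n
    aw≡b^j[al] : a * w ≡ b ^ j * (a * l)
    aw≡b^j[al] = x∙yz≈y∙xz a (b ^ j) l
    0<aw : 0 < a * w
    0<aw = *-mono-≤ 0<a (*-mono-≤ (m^n>0 b j) (∤⇒0< b∤l))

module ExpectedSize (p : ℚ) (a b n i : ℕ) (0<a : 0 Data.Nat.< a) (a<b : a Data.Nat.< b)
                    (coprime : Coprime b a) (i≤n : i Data.Nat.≤ n) where
  import Data.Nat as ℕ
  open import Data.Bool.Properties using (∧-zeroʳ)
  open import Data.List.Properties using (map-∘)
  open import Data.Rational using (_*_)
  open import Data.Rational.Properties using (*-zeroʳ; *-identityʳ)
  open Cast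
  open Sums
  open Counting using (countUpTo; subpowerᵇ≡isYes)
  open Basic using (map-range1-cong)
  open Prefix using (dependsOnFirst-∘)
  open Expectation p
  open EvenProbability
  open Distance p a b n 0<a a<b coprime using (b≢0; atEvenDistance; 𝔼-atEvenDistance; atEvenDistance-dependsOnFirst)
  open ≡-Reasoning

  inTStar : List Bool → ℕ → Bool
  inTStar S v = mem S v ∧ subpowerᵇ b i v ∧ evenᵇ (dist a b n S v)

  𝔼-inTStar : ∀ v → 0 ℕ.< v → v ℕ.≤ n →
              𝔼 n (λ S → 𝟙 (inTStar S v)) ≡ (p * evenProbability p i) * 𝟙 (subpowerᵇ b i v)
  𝔼-inTStar v 0<v v≤n rewrite subpowerᵇ≡isYes b i v with subpower? b i v
  ... | no _ =
    trans (𝔼-cong n (λ S → cong 𝟙 (∧-zeroʳ (mem S v))))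
          (trans (𝔼-const n 0ℚ) (sym (*-zeroʳ (p * evenProbability p i))))
  ... | yes (l , v≡b^il , b∤l) = begin
    𝔼 n (λ S → 𝟙 (mem S v ∧ atEvenDistance S n v))
      ≡⟨ 𝔼-cong n (λ S → 𝟙-∧ (mem S v) (atEvenDistance S n v)) ⟩
    𝔼 n (λ S → 𝟙 (mem S v) * 𝟙 (atEvenDistance S n v))
      ≡⟨ 𝔼-independent 0<v v≤n (dependsOnFirst-∘ 𝟙 (atEvenDistance-dependsOnFirst n v v≤n)) ⟩
    p * 𝔼 n (λ S → 𝟙 (atEvenDistance S n v))
      ≡⟨ cong (p *_) (subst (λ v → 𝔼 n (λ S → 𝟙 (atEvenDistance S n v)) ≡ evenProbability p i) (sym v≡b^il)
                            (𝔼-atEvenDistance i l n b∤l (subst (ℕ._≤ n) v≡b^il v≤n) i≤n)) ⟩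
    p * evenProbability p i
      ≡⟨ sym (*-identityʳ (p * evenProbability p i)) ⟩
    (p * evenProbability p i) * 1ℚ ∎

  expectedTStar-formula : expectedTStar p a b n i ≡ (p * evenProbability p i) * ℕ→ℚ (countUpTo (subpowerᵇ b i) n)
  expectedTStar-formula = begin
    expectedTStar p a b n i
      ≡⟨ weightedSum≡𝔼 n (λ S → ℕ→ℚ (length (TStar a b n i S))) ⟩
    𝔼 n (λ S → ℕ→ℚ (length (TStar a b n i S)))
      ≡⟨ 𝔼-cong n (λ S → length-filter (inTStar S) (range1 n)) ⟩
    𝔼 n (λ S → sumℚ (map (λ v → 𝟙 (inTStar S v)) (range1 n)))
      ≡⟨ 𝔼-sumℚ n (λ S v → 𝟙 (inTStar S v)) (range1 n) ⟩
    sumℚ (map (λ v → 𝔼 n (λ S → 𝟙 (inTStar S v))) (range1 n))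
      ≡⟨ cong sumℚ (trans (map-range1-cong n 𝔼-inTStar) (map-∘ (range1 n))) ⟩
    sumℚ (map (t *_) (map (𝟙 ∘ subpowerᵇ b i) (range1 n)))
      ≡⟨ sumℚ-*ˡ t (map (𝟙 ∘ subpowerᵇ b i) (range1 n)) ⟩
    t * sumℚ (map (𝟙 ∘ subpowerᵇ b i) (range1 n))
      ≡⟨ cong (t *_) (sumℚ-countUpTo (subpowerᵇ b i) n) ⟩
    t * ℕ→ℚ (countUpTo (subpowerᵇ b i) n) ∎
    where t = p * evenProbability p i

module MainTerm where
  open import Data.Nat as ℕ using (_∸_; _^_)
  open import Data.Rational
  open import Data.Rational.Properties
  open import Data.Rational.Solver using (module +-*-Solver)
  open +-*-Solver
  open import Data.Sum using (inj₁; inj₂)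
  open Cast
  open EvenProbability

  inv-inverseˡ : ∀ {x} → 0ℚ < x → inv x * x ≡ 1ℚ
  inv-inverseˡ {x} 0<x with x ≟ 0ℚ
  ... | yes x≡0 = ⊥-elim (<⇒≢ 0<x (sym x≡0))
  ... | no x≢0  = *-inverseˡ x {{≢-nonZero x≢0}}

  powℚ-* : ∀ x y i → powℚ (x * y) i ≡ powℚ x i * powℚ y i
  powℚ-* x y zero    = refl
  powℚ-* x y (suc i) rewrite powℚ-* x y i =
    solve 4 (λ x y a b → (x :* y) :* (a :* b) := (x :* a) :* (y :* b)) refl x y (powℚ x i) (powℚ y i)

  powℚ-1 : ∀ i → powℚ 1ℚ i ≡ 1ℚ
  powℚ-1 zero    = refl
  powℚ-1 (suc i) = trans (*-identityˡ (powℚ 1ℚ i)) (powℚ-1 i)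

  powℚ-inv-inverseˡ : ∀ {x} → 0ℚ < x → ∀ i → powℚ (inv x) i * powℚ x i ≡ 1ℚ
  powℚ-inv-inverseˡ {x} 0<x i =
    trans (sym (powℚ-* (inv x) x i)) (trans (cong (λ z → powℚ z i) (inv-inverseˡ 0<x)) (powℚ-1 i))

  mainTerm-scaled : ∀ p b n i → 0ℚ ≤ p → 0 ℕ.< b →
    mainTerm p b n i * ℕ→ℚ (b ^ suc i) ≡ (p * evenProbability p i) * (ℕ→ℚ (b ∸ 1) * ℕ→ℚ n)
  mainTerm-scaled p b n i 0≤p 0<b = begin
    ((μ * X) * (p * ν)) * (Y + powℚ (- (p * Z)) i * p) * ℕ→ℚ (b ^ suc i)
      ≡⟨ cong₂ (λ w K → ((μ * X) * (p * ν)) * (Y + w * p) * K)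
               (trans (cong (λ z → powℚ z i) (neg-distribˡ-* p Z)) (powℚ-* (- p) Z i))
               (ℕ→ℚ-* b (b ^ i)) ⟩
    ((μ * X) * (p * ν)) * (Y + (P * Zᵢ) * p) * (β * δ)
      ≡⟨ solve 9 (λ μ X p ν Y P Zᵢ β δ → ((μ :* X) :* (p :* ν)) :* (Y :+ (P :* Zᵢ) :* p) :* (β :* δ)
                                      := (μ :* p :* ν) :* (X :* β) :* (Y :* δ :+ P :* p :* (Zᵢ :* δ)))
               refl μ X p ν Y P Zᵢ β δ ⟩
    (μ * p * ν) * (X * β) * (Y * δ + P * p * (Zᵢ * δ))
      ≡⟨ cong₂ (λ u v → (μ * p * ν) * (X * β) * (u + P * p * v))
               (inv-inverseˡ 0<δ)
               (trans (cong (Zᵢ *_) (ℕ→ℚ-^ b i)) (powℚ-inv-inverseˡ 0<β i)) ⟩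
    (μ * p * ν) * (X * β) * (1ℚ + P * p * 1ℚ)
      ≡⟨ cong ((μ * p * ν) * (X * β) *_)
              (trans (cong (1ℚ +_) (*-identityʳ (P * p))) (sym (evenProbability-closedForm p i))) ⟩
    (μ * p * ν) * (X * β) * (s * (1ℚ + p))
      ≡⟨ solve 6 (λ μ p ν X β s → (μ :* p :* ν) :* (X :* β) :* (s :* (con 1ℚ :+ p))
                                := (p :* s) :* (μ :* ν) :* (X :* (β :* (con 1ℚ :+ p))))
               refl μ p ν X β s ⟩
    (p * s) * (μ * ν) * (X * (β * (1ℚ + p)))
      ≡⟨ trans (cong ((p * s) * (μ * ν) *_) (inv-inverseˡ 0<β[1+p])) (*-identityʳ ((p * s) * (μ * ν))) ⟩
    (p * s) * (μ * ν) ∎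
    where
    open ≡-Reasoning
    β = ℕ→ℚ b
    δ = ℕ→ℚ (b ^ i)
    μ = ℕ→ℚ (b ∸ 1)
    ν = ℕ→ℚ n
    s = evenProbability p i
    P = powℚ (- p) i
    X = inv (β * (1ℚ + p))
    Y = inv δ
    Z = inv β
    Zᵢ = powℚ Z i
    0<β : 0ℚ < β
    0<β = ℕ→ℚ-pos 0<b
    0<δ : 0ℚ < δ
    0<δ = ℕ→ℚ-pos (ℕP.m^n>0 b {{ℕ.>-nonZero 0<b}} i)
      where import Data.Nat.Properties as ℕP
    0<β[1+p] : 0ℚ < β * (1ℚ + p)
    0<β[1+p] = positive⁻¹ (β * (1ℚ + p))
      {{pos*pos⇒pos β {{positive 0<β}} (1ℚ + p) {{pos+nonNeg⇒pos 1ℚ p {{nonNegative 0≤p}}}}}}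

  ∣-∣≤ : ∀ {x y K} → x ≤ y + K → y ≤ x + K → ∣ x - y ∣ ≤ K
  ∣-∣≤ {x} {y} {K} x≤y+K y≤x+K with ∣p∣≡p∨∣p∣≡-p (x - y)
  ... | inj₁ ∣x-y∣≡x-y = begin
    ∣ x - y ∣     ≡⟨ ∣x-y∣≡x-y ⟩
    x - y         ≤⟨ +-monoˡ-≤ (- y) x≤y+K ⟩
    (y + K) - y   ≡⟨ solve 2 (λ y K → (y :+ K) :- y := K) refl y K ⟩
    K             ∎
    where open ≤-Reasoning
  ... | inj₂ ∣x-y∣≡y-x = begin
    ∣ x - y ∣     ≡⟨ trans ∣x-y∣≡y-x (solve 2 (λ x y → :- (x :- y) := y :- x) refl x y) ⟩
    y - x         ≤⟨ +-monoˡ-≤ (- x) y≤x+K ⟩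
    (x + K) - x   ≡⟨ solve 2 (λ x K → (x :+ K) :- x := K) refl x K ⟩
    K             ∎
    where open ≤-Reasoning

  -- If m = t y / K, then t x - m = t (x K - y) / K.
  scaled-error-bound : ∀ {K t x y m} → 0ℚ < K → ∈[0,1] t → m * K ≡ t * y →
                       x * K ≤ y + K → y ≤ x * K + K → ∣ t * x - m ∣ ≤ 1ℚ
  scaled-error-bound {K} {t} {x} {y} {m} 0<K (0≤t , t≤1) mK≡ty xK≤y+K y≤xK+K =
    *-cancelʳ-≤-pos K {{positive 0<K}} (begin
      ∣ t * x - m ∣ * K                 ≡⟨ cong (∣ t * x - m ∣ *_) (sym (0≤p⇒∣p∣≡p (<⇒≤ 0<K))) ⟩
      ∣ t * x - m ∣ * ∣ K ∣             ≡⟨ sym (∣p*q∣≡∣p∣*∣q∣ (t * x - m) K) ⟩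
      ∣ (t * x - m) * K ∣               ≡⟨ cong ∣_∣ error×K ⟩
      ∣ t * (x * K - y) ∣               ≡⟨ ∣p*q∣≡∣p∣*∣q∣ t (x * K - y) ⟩
      ∣ t ∣ * ∣ x * K - y ∣             ≡⟨ cong (_* ∣ x * K - y ∣) (0≤p⇒∣p∣≡p 0≤t) ⟩
      t * ∣ x * K - y ∣                 ≤⟨ *-monoʳ-≤-nonNeg ∣ x * K - y ∣ {{∣-∣-nonNeg (x * K - y)}} t≤1 ⟩
      1ℚ * ∣ x * K - y ∣                ≤⟨ *-monoˡ-≤-nonNeg 1ℚ (∣-∣≤ xK≤y+K y≤xK+K) ⟩
      1ℚ * K                            ∎)
    where
    open ≤-Reasoning
    error×K : (t * x - m) * K ≡ t * (x * K - y)
    error×K = begin-equality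
      (t * x - m) * K        ≡⟨ solve 4 (λ t x m K → (t :* x :- m) :* K := t :* (x :* K) :- m :* K) refl t x m K ⟩
      t * (x * K) - m * K    ≡⟨ cong (λ z → t * (x * K) - z) mK≡ty ⟩
      t * (x * K) - t * y    ≡⟨ solve 3 (λ t u y → t :* u :- t :* y := t :* (u :- y)) refl t (x * K) y ⟩
      t * (x * K - y)        ∎

  subpowerCount-boundsℚ : ∀ b₁ i n →
    let x = ℕ→ℚ (Counting.countUpTo (subpowerᵇ (suc b₁) i) n)
        K = ℕ→ℚ (suc b₁ ^ suc i)
        y = ℕ→ℚ b₁ * ℕ→ℚ n
    in x * K ≤ y + K × y ≤ x * K + K
  subpowerCount-boundsℚ b₁ i n =
    subst₂ _≤_ (ℕ→ℚ-* c K) (trans (ℕ→ℚ-+ (b₁ ℕ.* n) K) (cong (_+ ℕ→ℚ K) (ℕ→ℚ-* b₁ n))) (ℕ→ℚ-mono-≤ upper) ,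
    subst₂ _≤_ (ℕ→ℚ-* b₁ n) (trans (ℕ→ℚ-+ (c ℕ.* K) K) (cong (_+ ℕ→ℚ K) (ℕ→ℚ-* c K))) (ℕ→ℚ-mono-≤ lower)
    where
    c = Counting.countUpTo (subpowerᵇ (suc b₁) i) n
    K = suc b₁ ^ suc i
    upper = proj₁ (Counting.subpowerCount-bounds b₁ i n)
    lower = proj₂ (Counting.subpowerCount-bounds b₁ i n)

open import Data.Nat using (_<_; _≤_; _^_; s≤s; z≤n; s≤s⁻¹)
open import Data.Nat.Properties using (≤-trans; <-≤-trans; <⇒≤; m^n>0)
open import Data.Nat.GCD using (gcd)
import Data.Nat.Coprimality as Coprimality
open import Data.Rational using (_-_; ∣_∣) renaming (_<_ to _<ℚ_; _≤_ to _≤ℚ_)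
open import Data.Rational.Properties using () renaming (<⇒≤ to <⇒≤ℚ)

corollary3p4 : (p : ℚ) → 0ℚ <ℚ p → p <ℚ 1ℚ →
               (a b : ℕ) → 0 < a → a < b → gcd a b ≡ 1 →
               (n : ℕ) → 0 < n →
               (i : ℕ) → b ^ i ≤ n →
               ∣ expectedTStar p a b n i - mainTerm p b n i ∣ ≤ℚ 1ℚ
corollary3p4 p 0<p p<1 a (suc b₁) 0<a a<b gcd≡1 n _ i b^i≤n =
  subst (λ e → ∣ e - mainTerm p (suc b₁) n i ∣ ≤ℚ 1ℚ) (sym expectedTStar-formula)
    (scaled-error-bound (ℕ→ℚ-pos (m^n>0 (suc b₁) (suc i))) (*-∈[0,1] p∈[0,1] (evenProbability-∈[0,1] p∈[0,1] i))
      (mainTerm-scaled p (suc b₁) n i (<⇒≤ℚ 0<p) (s≤s z≤n))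
      (proj₁ (subpowerCount-boundsℚ b₁ i n)) (proj₂ (subpowerCount-boundsℚ b₁ i n)))
  where
  open Cast
  open EvenProbability
  open MainTerm
  coprime = Coprimality.sym (Coprimality.gcd≡1⇒coprime gcd≡1)
  i≤n = <⇒≤ (<-≤-trans (Counting.n<[1+m]^n b₁ i (≤-trans 0<a (s≤s⁻¹ a<b))) b^i≤n)
  p∈[0,1] = <⇒≤ℚ 0<p , <⇒≤ℚ p<1
  open ExpectedSize p a (suc b₁) n i 0<a a<b coprime i≤n using (expectedTStar-formula)
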